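{- Let $m \geq 1$ be an integer. The clique number of the graph $\mathrm{Cay}(\sigma_m)$ is at most $\rho(2^m)$, where $\rho$ is the Hurwitz-Radon function. Moreover, $\rho(2^m) < 2^m$ for $m \geq 4$.
   Context: Identify each $i \in \mathbb{Z}_2^{2m}$ with a bit string of length $2m$, read as an $m$-digit base-4 number by grouping consecutive pairs of bits, each pair $(b_{2k+1}, b_{2k})$ giving the base-4 digit $2b_{2k+1}+b_{2k}$. Define $\sigma_m:\mathbb{Z}_2^{2m}\to\mathbb{Z}_2$ by $\sigma_m(i)=1$ if and only if the number of base-4 digits of $i$ equal to $1$ is odd. The Cayley graph $\mathrm{Cay}(\sigma_m)$ is the simple undirected graph with vertex set $\mathbb{Z}_2^{2m}$ in which distinct vertices $i,j$ are adjacent if and only if $\sigma_m(i+j)=1$. The Hurwitz-Radon function is defined on powers of $2$ by $\rho(2^{4d+c}) = 2^c + 8d$ for integers $d \geq 0$ and $0 \leq c < 4$. -}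

module Defs where

open import Data.Bool using (Bool; true; false; not; _xor_)
open import Data.Nat using (ℕ; zero; suc; _+_; _*_; _^_; _%_; _/_)
open import Data.Vec using (Vec; toList; zipWith)
open import Data.List using (List; []; _∷_)
open import Data.Fin using (Fin)
open import Relation.Binary.PropositionalEquality using (_≡_)
open import Relation.Nullary using (¬_)
open import Data.Product using (_×_)

Vertex : ℕ → Set
Vertex m = Vec Bool (2 * m)

_⊕_ : ∀ {m} → Vertex m → Vertex m → Vertex m
_⊕_ = zipWith _xor_

-- Parity of the number of base-4 digits equal to 1, reading the list
-- b_0 b_1 b_2 b_3 … in consecutive pairs (b_{2k}, b_{2k+1});
-- the digit 2 b_{2k+1} + b_{2k} equals 1 iff b_{2k} = 1 and b_{2k+1} = 0.
oddOnes : List Bool → Bool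
oddOnes (true ∷ false ∷ bs) = not (oddOnes bs)
oddOnes (_ ∷ _ ∷ bs) = oddOnes bs
oddOnes _ = false

σ : ∀ m → Vertex m → Bool
σ m i = oddOnes (toList i)

Adj : ∀ m → Vertex m → Vertex m → Set
Adj m i j = ¬ (i ≡ j) × σ m (_⊕_ {m} i j) ≡ true

IsClique : ∀ m {k} → (Fin k → Vertex m) → Set
IsClique m {k} v = ∀ (a b : Fin k) → ¬ (a ≡ b) → Adj m (v a) (v b)

-- Hurwitz–Radon function on powers of two: ρHR n = ρ(2^n),
-- where ρ(2^{4d+c}) = 2^c + 8d with d = n / 4, c = n % 4.
ρHR : ℕ → ℕ
ρHR n = 2 ^ (n % 4) + 8 * (n / 4)

-- Write q = σ for the quadratic form on 𝔽₂ⁿ read off pairs of bits, and B for its polar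
-- form, q (x + y) = q x + q y + B x y.  Translating a clique so that one vertex is 0, the
-- remaining vertices wᵢ satisfy q wᵢ = 1 and B wᵢ wⱼ = 1 for i ≠ j: a "frame".  Replacing
-- wᵢ (i ≥ 2) by wᵢ + w₀ + w₁ gives a frame of the opposite q-value orthogonal to w₀ and w₁,
-- so recursively a frame of size n yields an injective linear map combine : 𝔽₂ⁿ → 𝔽₂^{2m}
-- along which q becomes a sum of planes a ∨ b and a ∧ b, alternately (frameForm).
--
-- With m = r + 4d and ρ(2^m) = 2^r + 8d, a frame of size ρ(2^m) cannot exist: for r = 0, 3
-- its size exceeds 2m, contradicting injectivity; for r = 1, 2 its size is 2m, so by
-- injectivity q has at least as many ones as frameForm, whereas the biases Σ (-1)^f are 2^m
-- for q and −2^m for frameForm (the two forms have different Arf invariants).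
module Submission where

open import Defs
open import Level using (0ℓ)
open import Function using (_∘_; case_of_)
open import Data.Bool using (Bool; true; false; not; _∧_; _xor_; T)
open import Data.Bool.Properties
  using (xor-∧-commutativeRing; xor-assoc; xor-comm; xor-same; xor-identityʳ; xor-annihilates-not
        ; ∧-comm; ∧-zeroʳ; ∧-identityʳ)
open import Data.Fin using (Fin; zero; suc; inject≤)
open import Data.Fin.Properties using (suc-injective; inject≤-injective)
open import Data.Integer as ℤ using (ℤ; +_; -[1+_]; 0ℤ; 1ℤ; -1ℤ)
import Data.Integer.Properties as ℤ
import Data.Integer.Tactic.RingSolver as ℤ-Solver
open import Data.List using (List; []; _∷_; _++_; map; length; filterᵇ; cartesianProductWith)
open import Data.List.Membership.Propositional using (_∈_; _─_)
open import Data.List.Membership.Propositional.Properties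
  using (∈-map⁻; ∈-filter⁺; ∈-filter⁻; ∈-cartesianProductWith⁺)
open import Data.List.Properties using (length-map; length-++; filter-++; ++-identityʳ; length-removeAt′)
open import Data.List.Relation.Binary.Subset.Propositional using (_⊆_)
open import Data.List.Relation.Unary.All as All using ([]; _∷_)
open import Data.List.Relation.Unary.AllPairs using ([]; _∷_)
open import Data.List.Relation.Unary.Any using (here; there; index)
open import Data.List.Relation.Unary.Unique.Propositional using (Unique)
import Data.List.Relation.Unary.Unique.Propositional.Properties as Unique
open import Data.Maybe using (just; nothing)
open import Data.Nat using (ℕ; zero; suc; _+_; _*_; _^_; _%_; _/_; _≤_; _<_; z≤n; s≤s)
open import Data.Nat.DivMod using (m≡m%n+[m/n]*n; m%n<n; m≥n⇒m/n>0)
open import Data.Nat.Properties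
  using (module ≤-Reasoning; ≤-reflexive; ≤-trans; ≮⇒≥; <⇒≱; ≰⇒>; +-comm; *-comm; +-identityʳ
        ; *-suc; *-distribˡ-+; +-monoʳ-≤; +-monoˡ-≤; *-monoʳ-≤; *-monoʳ-<; m≤m+n; m≤n+m; m<n+m
        ; m≤m*n; m≤n*m; ^-monoʳ-<; ^-distribˡ-+-*; m^n≢0)
import Data.Nat.Tactic.RingSolver as ℕ-Solver
open import Data.Product using (_×_; _,_; proj₂)
open import Data.Unit using (⊤; tt)
open import Data.Vec using (Vec; []; _∷_; zipWith; replicate; toList)
open import Data.Vec.Properties using (zipWith-assoc; zipWith-identityˡ; ∷-injective)
open import Relation.Binary.PropositionalEquality
open import Relation.Nullary using (¬_; contradiction)
open import Relation.Nullary.Decidable using (T?)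
open import Tactic.RingSolver using (solve-∀)
open import Tactic.RingSolver.Core.AlmostCommutativeRing using (AlmostCommutativeRing; fromCommutativeRing)

private
  variable
    n N : ℕ

xor-∧-ring : AlmostCommutativeRing 0ℓ 0ℓ
xor-∧-ring = fromCommutativeRing xor-∧-commutativeRing λ { false → just refl ; true → nothing }

infixl 6 _+ᵥ_
infixr 7 _·_

_+ᵥ_ : Vec Bool n → Vec Bool n → Vec Bool n
_+ᵥ_ = zipWith _xor_

0ᵥ : Vec Bool n
0ᵥ = replicate _ false

_·_ : Bool → Vec Bool n → Vec Bool n
true  · x = x
false · x = 0ᵥ

+ᵥ-assoc : ∀ (x y z : Vec Bool n) → (x +ᵥ y) +ᵥ z ≡ x +ᵥ (y +ᵥ z)
+ᵥ-assoc = zipWith-assoc xor-assoc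

+ᵥ-identityˡ : ∀ (x : Vec Bool n) → 0ᵥ +ᵥ x ≡ x
+ᵥ-identityˡ = zipWith-identityˡ λ _ → refl

+ᵥ-self : ∀ (x : Vec Bool n) → x +ᵥ x ≡ 0ᵥ
+ᵥ-self [] = refl
+ᵥ-self (a ∷ x) = cong₂ _∷_ (xor-same a) (+ᵥ-self x)

+ᵥ-cancelˡ : ∀ (x : Vec Bool n) {y z} → x +ᵥ y ≡ x +ᵥ z → y ≡ z
+ᵥ-cancelˡ x {y} {z} eq = begin
  y              ≡⟨ x+x+ y ⟨
  x +ᵥ (x +ᵥ y)  ≡⟨ cong (x +ᵥ_) eq ⟩
  x +ᵥ (x +ᵥ z)  ≡⟨ x+x+ z ⟩
  z              ∎
  where
  open ≡-Reasoning
  x+x+ : ∀ u → x +ᵥ (x +ᵥ u) ≡ u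
  x+x+ u = trans (sym (+ᵥ-assoc x x u)) (trans (cong (_+ᵥ u) (+ᵥ-self x)) (+ᵥ-identityˡ u))

+ᵥ-translate : ∀ (u x y : Vec Bool n) → (u +ᵥ x) +ᵥ (u +ᵥ y) ≡ x +ᵥ y
+ᵥ-translate [] [] [] = refl
+ᵥ-translate (false ∷ u) (b ∷ x) (c ∷ y) = cong ((b xor c) ∷_) (+ᵥ-translate u x y)
+ᵥ-translate (true  ∷ u) (b ∷ x) (c ∷ y) = cong₂ _∷_ (xor-annihilates-not b c) (+ᵥ-translate u x y)

-- The quadratic form and its polar form

q : Vec Bool n → Bool
q x = oddOnes (toList x)

q-∷∷ : ∀ a b (x : Vec Bool n) → q (a ∷ b ∷ x) ≡ (a ∧ not b) xor q x
q-∷∷ true  true  x = refl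
q-∷∷ true  false x = refl
q-∷∷ false true  x = refl
q-∷∷ false false x = refl

q-[_] : ∀ a → q (a ∷ []) ≡ false
q-[ true  ] = refl
q-[ false ] = refl

q-0ᵥ : q (0ᵥ {n}) ≡ false
q-0ᵥ {zero} = refl
q-0ᵥ {suc zero} = refl
q-0ᵥ {suc (suc n)} = q-0ᵥ {n}

q-· : ∀ e (x : Vec Bool n) → q (e · x) ≡ e ∧ q x
q-· true  x = refl
q-· {n} false x = q-0ᵥ {n}

B : Vec Bool n → Vec Bool n → Bool
B [] [] = false
B (_ ∷ []) (_ ∷ []) = false
B (a ∷ b ∷ x) (c ∷ d ∷ y) = ((a ∧ d) xor (b ∧ c)) xor B x y

-- In the ring identities below `true xor b` stands for `not b`, which the ring solver cannot read.

q-polar : ∀ (x y : Vec Bool n) → q (x +ᵥ y) ≡ (q x xor q y) xor B x y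
q-polar [] [] = refl
q-polar (a ∷ []) (c ∷ []) =
  trans q-[ a xor c ] (sym (cong₂ (λ u v → (u xor v) xor false) q-[ a ] q-[ c ]))
q-polar (a ∷ b ∷ x) (c ∷ d ∷ y) = begin
  q ((a xor c) ∷ (b xor d) ∷ (x +ᵥ y))
    ≡⟨ q-∷∷ (a xor c) (b xor d) (x +ᵥ y) ⟩
  ((a xor c) ∧ not (b xor d)) xor q (x +ᵥ y)
    ≡⟨ cong (((a xor c) ∧ not (b xor d)) xor_) (q-polar x y) ⟩
  ((a xor c) ∧ not (b xor d)) xor ((q x xor q y) xor B x y)
    ≡⟨ regroup a b c d (q x) (q y) (B x y) ⟩
  (((a ∧ not b) xor q x) xor ((c ∧ not d) xor q y)) xor (((a ∧ d) xor (b ∧ c)) xor B x y)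
    ≡⟨ cong₂ (λ u v → (u xor v) xor (((a ∧ d) xor (b ∧ c)) xor B x y)) (q-∷∷ a b x) (q-∷∷ c d y) ⟨
  (q (a ∷ b ∷ x) xor q (c ∷ d ∷ y)) xor B (a ∷ b ∷ x) (c ∷ d ∷ y)
    ∎
  where
  open ≡-Reasoning
  regroup : ∀ a b c d s t u →
            ((a xor c) ∧ (true xor (b xor d))) xor ((s xor t) xor u)
          ≡ (((a ∧ (true xor b)) xor s) xor ((c ∧ (true xor d)) xor t)) xor (((a ∧ d) xor (b ∧ c)) xor u)
  regroup = solve-∀ xor-∧-ring

B-comm : ∀ (x y : Vec Bool n) → B x y ≡ B y x
B-comm [] [] = refl
B-comm (_ ∷ []) (_ ∷ []) = refl
B-comm (a ∷ b ∷ x) (c ∷ d ∷ y) = trans (cong (((a ∧ d) xor (b ∧ c)) xor_) (B-comm x y)) (swap a b c d (B y x))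
  where
  swap : ∀ a b c d u → ((a ∧ d) xor (b ∧ c)) xor u ≡ ((c ∧ b) xor (d ∧ a)) xor u
  swap = solve-∀ xor-∧-ring

B-self : ∀ (x : Vec Bool n) → B x x ≡ false
B-self [] = refl
B-self (_ ∷ []) = refl
B-self (a ∷ b ∷ x) rewrite B-self x | ∧-comm b a | xor-same (a ∧ b) = refl

B-+ᵥˡ : ∀ (x y z : Vec Bool n) → B (x +ᵥ y) z ≡ B x z xor B y z
B-+ᵥˡ [] [] [] = refl
B-+ᵥˡ (_ ∷ []) (_ ∷ []) (_ ∷ []) = refl
B-+ᵥˡ (a ∷ b ∷ x) (a′ ∷ b′ ∷ y) (c ∷ d ∷ z) =
  trans (cong ((((a xor a′) ∧ d) xor ((b xor b′) ∧ c)) xor_) (B-+ᵥˡ x y z))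
        (regroup a b a′ b′ c d (B x z) (B y z))
  where
  regroup : ∀ a b a′ b′ c d s t →
            (((a xor a′) ∧ d) xor ((b xor b′) ∧ c)) xor (s xor t)
          ≡ (((a ∧ d) xor (b ∧ c)) xor s) xor (((a′ ∧ d) xor (b′ ∧ c)) xor t)
  regroup = solve-∀ xor-∧-ring

B-+ᵥʳ : ∀ (x y z : Vec Bool n) → B x (y +ᵥ z) ≡ B x y xor B x z
B-+ᵥʳ x y z = begin
  B x (y +ᵥ z)     ≡⟨ B-comm x (y +ᵥ z) ⟩
  B (y +ᵥ z) x     ≡⟨ B-+ᵥˡ y z x ⟩
  B y x xor B z x  ≡⟨ cong₂ _xor_ (B-comm y x) (B-comm z x) ⟩
  B x y xor B x z  ∎
  where open ≡-Reasoning

B-0ᵥ : ∀ (x : Vec Bool n) → B x 0ᵥ ≡ false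
B-0ᵥ x = trans (cong (B x) (sym (+ᵥ-self x))) (trans (B-+ᵥʳ x x x) (xor-same (B x x)))

B-·ʳ : ∀ e (x y : Vec Bool n) → B x (e · y) ≡ e ∧ B x y
B-·ʳ true  x y = refl
B-·ʳ false x y = B-0ᵥ x

B-· : ∀ a b (x y : Vec Bool n) → B (a · x) (b · y) ≡ a ∧ (b ∧ B x y)
B-· a b x y = begin
  B (a · x) (b · y)    ≡⟨ B-comm (a · x) (b · y) ⟩
  B (b · y) (a · x)    ≡⟨ B-·ʳ a (b · y) x ⟩
  a ∧ B (b · y) x      ≡⟨ cong (a ∧_) (trans (B-comm (b · y) x) (B-·ʳ b x y)) ⟩
  a ∧ (b ∧ B x y)      ∎
  where open ≡-Reasoning

B-pair : ∀ (x : Vec Bool n) a b u v → B x (a · u +ᵥ b · v) ≡ (a ∧ B x u) xor (b ∧ B x v)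
B-pair x a b u v = trans (B-+ᵥʳ x (a · u) (b · v)) (cong₂ _xor_ (B-·ʳ a x u) (B-·ʳ b x v))

B-pair-false : ∀ (x : Vec Bool n) a b {u v} → B x u ≡ false → B x v ≡ false → B x (a · u +ᵥ b · v) ≡ false
B-pair-false x a b {u} {v} xu xv rewrite B-pair x a b u v | xu | xv | ∧-zeroʳ a | ∧-zeroʳ b = refl

B-via-q : ∀ (x y : Vec Bool n) → B x y ≡ (q x xor q y) xor q (x +ᵥ y)
B-via-q x y = sym (begin
  s xor q (x +ᵥ y)     ≡⟨ cong (s xor_) (q-polar x y) ⟩
  s xor (s xor B x y)  ≡⟨ xor-assoc s s (B x y) ⟨
  (s xor s) xor B x y  ≡⟨ cong (λ t → t xor B x y) (xor-same s) ⟩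
  B x y                ∎)
  where
  open ≡-Reasoning
  s = q x xor q y

-- Frames

record IsFrame (c : Bool) (w : Fin n → Vec Bool N) : Set where
  field
    q-frame : ∀ i → q (w i) ≡ c
    B-frame : ∀ {i j} → i ≢ j → B (w i) (w j) ≡ true

-- A record rather than a function type, so that x and w can be inferred from a proof.
record _⟂_ (x : Vec Bool N) (w : Fin n → Vec Bool N) : Set where
  constructor ⟂-intro
  field orthogonal : ∀ i → B x (w i) ≡ false

open _⟂_

IsFrame-restrict : ∀ {s c} {w : Fin n → Vec Bool N} (s≤n : s ≤ n) → IsFrame c w →
                   IsFrame c (λ i → w (inject≤ i s≤n))
IsFrame-restrict s≤n F = record
  { q-frame = λ i → q-frame (inject≤ i s≤n)
  ; B-frame = λ i≢j → B-frame (i≢j ∘ inject≤-injective s≤n s≤n _ _)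
  }
  where open IsFrame F

clique⇒frame : ∀ {m k} {v : Fin (suc k) → Vertex m} → IsClique m v → IsFrame true (λ i → v zero +ᵥ v (suc i))
clique⇒frame {v = v} cl = record { q-frame = λ i → proj₂ (cl zero (suc i) λ ()) ; B-frame = B-frame }
  where
  B-frame : ∀ {i j} → i ≢ j → B (v zero +ᵥ v (suc i)) (v zero +ᵥ v (suc j)) ≡ true
  B-frame {i} {j} i≢j = begin
    B x y                         ≡⟨ B-via-q x y ⟩
    (q x xor q y) xor q (x +ᵥ y)  ≡⟨ cong₂ (λ s t → (s xor t) xor q (x +ᵥ y))
                                           (proj₂ (cl zero (suc i) λ ())) (proj₂ (cl zero (suc j) λ ())) ⟩
    q (x +ᵥ y)                    ≡⟨ cong q (+ᵥ-translate (v zero) (v (suc i)) (v (suc j))) ⟩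
    q (v (suc i) +ᵥ v (suc j))    ≡⟨ proj₂ (cl (suc i) (suc j) (i≢j ∘ suc-injective)) ⟩
    true                          ∎
    where
    open ≡-Reasoning
    x = v zero +ᵥ v (suc i)
    y = v zero +ᵥ v (suc j)

reduce : (Fin (suc (suc n)) → Vec Bool N) → Fin n → Vec Bool N
reduce w i = w (suc (suc i)) +ᵥ (w zero +ᵥ w (suc zero))

combine : (Fin n → Vec Bool N) → Vec Bool n → Vec Bool N
combine w [] = 0ᵥ
combine w (e ∷ []) = e · w zero
combine w (a ∷ b ∷ z) = (a · w zero +ᵥ b · w (suc zero)) +ᵥ combine (reduce w) z

pairForm : Bool → Bool → Bool → Bool
pairForm c a b = ((a ∧ c) xor (b ∧ c)) xor (a ∧ b)

frameForm : Bool → Vec Bool n → Bool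
frameForm c [] = false
frameForm c (e ∷ []) = e ∧ c
frameForm c (a ∷ b ∷ z) = pairForm c a b xor frameForm (not c) z

⟂-reduce : ∀ {x : Vec Bool N} {w : Fin (suc (suc n)) → Vec Bool N} → x ⟂ w → x ⟂ reduce w
⟂-reduce {x = x} {w} (⟂-intro x⟂w) = ⟂-intro x⟂reduce
  where
  x⟂reduce : ∀ i → B x (reduce w i) ≡ false
  x⟂reduce i rewrite B-+ᵥʳ x (w (suc (suc i))) (w zero +ᵥ w (suc zero)) | B-+ᵥʳ x (w zero) (w (suc zero))
                   | x⟂w (suc (suc i)) | x⟂w zero | x⟂w (suc zero) = refl

module _ {c : Bool} {w : Fin (suc (suc n)) → Vec Bool N} (F : IsFrame c w) where
  open IsFrame F

  private
    w₀ w₁ s : Vec Bool N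
    w₀ = w zero
    w₁ = w (suc zero)
    s = w₀ +ᵥ w₁

    B₀₁ : B w₀ w₁ ≡ true
    B₀₁ = B-frame λ ()

    q-s : q s ≡ true
    q-s rewrite q-polar w₀ w₁ | q-frame zero | q-frame (suc zero) | B₀₁ | xor-same c = refl

    B-s : ∀ i → B (w (suc (suc i))) s ≡ false
    B-s i rewrite B-+ᵥʳ (w (suc (suc i))) w₀ w₁ | B-frame {suc (suc i)} {zero} (λ ())
                | B-frame {suc (suc i)} {suc zero} (λ ()) = refl

  reduce-isFrame : IsFrame (not c) (reduce w)
  reduce-isFrame = record { q-frame = q-reduce ; B-frame = B-reduce }
    where
    q-reduce : ∀ i → q (reduce w i) ≡ not c
    q-reduce i rewrite q-polar (w (suc (suc i))) s | q-frame (suc (suc i)) | q-s | B-s i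
      = trans (xor-identityʳ (c xor true)) (xor-comm c true)

    B-reduce : ∀ {i j} → i ≢ j → B (reduce w i) (reduce w j) ≡ true
    B-reduce {i} {j} i≢j
      rewrite B-+ᵥˡ (w (suc (suc i))) s (reduce w j)
            | B-+ᵥʳ (w (suc (suc i))) (w (suc (suc j))) s | B-+ᵥʳ s (w (suc (suc j))) s
            | B-frame (i≢j ∘ suc-injective ∘ suc-injective)
            | B-s i | B-comm s (w (suc (suc j))) | B-s j | B-self s = refl

  w₀⟂reduce : w₀ ⟂ reduce w
  w₀⟂reduce = ⟂-intro w₀⟂
    where
    w₀⟂ : ∀ i → B w₀ (reduce w i) ≡ false
    w₀⟂ i rewrite B-+ᵥʳ w₀ (w (suc (suc i))) s | B-+ᵥʳ w₀ w₀ w₁ | B-self w₀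
                | B-frame {zero} {suc (suc i)} (λ ()) | B₀₁ = refl

  w₁⟂reduce : w₁ ⟂ reduce w
  w₁⟂reduce = ⟂-intro w₁⟂
    where
    w₁⟂ : ∀ i → B w₁ (reduce w i) ≡ false
    w₁⟂ i rewrite B-+ᵥʳ w₁ (w (suc (suc i))) s | B-+ᵥʳ w₁ w₀ w₁ | B-self w₁
                | B-frame {suc zero} {suc (suc i)} (λ ()) | B-frame {suc zero} {zero} (λ ()) = refl

  q-pair : ∀ a b → q (a · w₀ +ᵥ b · w₁) ≡ pairForm c a b
  q-pair a b = begin
    q (a · w₀ +ᵥ b · w₁)
      ≡⟨ q-polar (a · w₀) (b · w₁) ⟩
    (q (a · w₀) xor q (b · w₁)) xor B (a · w₀) (b · w₁)
      ≡⟨ cong₂ (λ s t → (s xor t) xor B (a · w₀) (b · w₁)) (q-· a w₀) (q-· b w₁) ⟩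
    ((a ∧ q w₀) xor (b ∧ q w₁)) xor B (a · w₀) (b · w₁)
      ≡⟨ cong₂ (λ s t → ((a ∧ s) xor (b ∧ t)) xor B (a · w₀) (b · w₁)) (q-frame zero) (q-frame (suc zero)) ⟩
    ((a ∧ c) xor (b ∧ c)) xor B (a · w₀) (b · w₁)
      ≡⟨ cong (((a ∧ c) xor (b ∧ c)) xor_) (trans (B-· a b w₀ w₁) (cong (λ t → a ∧ (b ∧ t)) B₀₁)) ⟩
    ((a ∧ c) xor (b ∧ c)) xor (a ∧ (b ∧ true))
      ≡⟨ cong (λ t → ((a ∧ c) xor (b ∧ c)) xor (a ∧ t)) (∧-identityʳ b) ⟩
    pairForm c a b
      ∎
    where open ≡-Reasoning

⟂-combine : ∀ {x : Vec Bool N} {w : Fin n → Vec Bool N} → x ⟂ w → ∀ z → B x (combine w z) ≡ false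
⟂-combine {x = x} x⟂w [] = B-0ᵥ x
⟂-combine {x = x} {w} x⟂w (e ∷ []) =
  trans (B-·ʳ e x (w zero)) (trans (cong (e ∧_) (orthogonal x⟂w zero)) (∧-zeroʳ e))
⟂-combine {x = x} {w} x⟂w (a ∷ b ∷ z) =
  trans (B-+ᵥʳ x (a · w zero +ᵥ b · w (suc zero)) (combine (reduce w) z))
        (cong₂ _xor_ (B-pair-false x a b (orthogonal x⟂w zero) (orthogonal x⟂w (suc zero)))
                     (⟂-combine (⟂-reduce x⟂w) z))

module _ {c : Bool} {w : Fin (suc (suc n)) → Vec Bool N} (F : IsFrame c w) where
  open IsFrame F

  private
    w₀ w₁ : Vec Bool N
    w₀ = w zero
    w₁ = w (suc zero)

    B-combine : ∀ {x} a b z → x ⟂ reduce w →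
                B x (combine w (a ∷ b ∷ z)) ≡ ((a ∧ B x w₀) xor (b ∧ B x w₁)) xor false
    B-combine {x} a b z x⟂ = trans (B-+ᵥʳ x (a · w₀ +ᵥ b · w₁) (combine (reduce w) z))
                                   (cong₂ _xor_ (B-pair x a b w₀ w₁) (⟂-combine x⟂ z))

  B₀-combine : ∀ a b z → B w₀ (combine w (a ∷ b ∷ z)) ≡ b
  B₀-combine a b z = begin
    B w₀ (combine w (a ∷ b ∷ z))
      ≡⟨ B-combine a b z (w₀⟂reduce F) ⟩
    ((a ∧ B w₀ w₀) xor (b ∧ B w₀ w₁)) xor false
      ≡⟨ cong₂ (λ s t → ((a ∧ s) xor (b ∧ t)) xor false) (B-self w₀) (B-frame λ ()) ⟩
    ((a ∧ false) xor (b ∧ true)) xor false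
      ≡⟨ cong₂ (λ s t → (s xor t) xor false) (∧-zeroʳ a) (∧-identityʳ b) ⟩
    b xor false
      ≡⟨ xor-identityʳ b ⟩
    b ∎
    where open ≡-Reasoning

  B₁-combine : ∀ a b z → B w₁ (combine w (a ∷ b ∷ z)) ≡ a
  B₁-combine a b z = begin
    B w₁ (combine w (a ∷ b ∷ z))
      ≡⟨ B-combine a b z (w₁⟂reduce F) ⟩
    ((a ∧ B w₁ w₀) xor (b ∧ B w₁ w₁)) xor false
      ≡⟨ cong₂ (λ s t → ((a ∧ s) xor (b ∧ t)) xor false) (B-frame λ ()) (B-self w₁) ⟩
    ((a ∧ true) xor (b ∧ false)) xor false
      ≡⟨ cong₂ (λ s t → (s xor t) xor false) (∧-identityʳ a) (∧-zeroʳ b) ⟩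
    (a xor false) xor false
      ≡⟨ trans (xor-identityʳ (a xor false)) (xor-identityʳ a) ⟩
    a ∎
    where open ≡-Reasoning

q-combine : ∀ {c} {w : Fin n → Vec Bool N} → IsFrame c w → ∀ z → q (combine w z) ≡ frameForm c z
q-combine {N = N} F [] = q-0ᵥ {N}
q-combine {w = w} F (e ∷ []) = trans (q-· e (w zero)) (cong (e ∧_) (IsFrame.q-frame F zero))
q-combine {N = N} {c = c} {w} F (a ∷ b ∷ z) = begin
  q (u +ᵥ r)
    ≡⟨ q-polar u r ⟩
  (q u xor q r) xor B u r
    ≡⟨ cong₂ (λ s t → (s xor t) xor B u r) (q-pair F a b) (q-combine (reduce-isFrame F) z) ⟩
  (pairForm c a b xor frameForm (not c) z) xor B u r
    ≡⟨ cong ((pairForm c a b xor frameForm (not c) z) xor_) u⟂r ⟩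
  (pairForm c a b xor frameForm (not c) z) xor false
    ≡⟨ xor-identityʳ _ ⟩
  pairForm c a b xor frameForm (not c) z
    ∎
  where
  open ≡-Reasoning
  u r : Vec Bool N
  u = a · w zero +ᵥ b · w (suc zero)
  r = combine (reduce w) z
  u⟂r : B u r ≡ false
  u⟂r = trans (B-comm u r) (B-pair-false r a b (trans (B-comm r (w zero)) (⟂-combine (w₀⟂reduce F) z))
                                               (trans (B-comm r (w (suc zero))) (⟂-combine (w₁⟂reduce F) z)))

-- For odd n the last frame vector enters `combine` on its own; it is nonzero as soon as its
-- q-value, which alternates with each reduction, is true.
TailNonzero : Bool → ℕ → Set
TailNonzero c zero = ⊤
TailNonzero c (suc zero) = c ≡ true
TailNonzero c (suc (suc n)) = TailNonzero (not c) n

tail-periodic : ∀ d {k} → TailNonzero true k → TailNonzero true (d * 8 + k)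
tail-periodic zero t = t
tail-periodic (suc d) t = tail-periodic d t

combine-injective : ∀ {c} {w : Fin n → Vec Bool N} → IsFrame c w → TailNonzero c n →
                    ∀ {z z′} → combine w z ≡ combine w z′ → z ≡ z′
combine-injective F t {[]} {[]} eq = refl
combine-injective F t {true ∷ []} {true ∷ []} eq = refl
combine-injective F t {false ∷ []} {false ∷ []} eq = refl
combine-injective {N = N} F refl {true ∷ []} {false ∷ []} eq =
  contradiction (trans (sym (IsFrame.q-frame F zero)) (trans (cong q eq) (q-0ᵥ {N}))) λ ()
combine-injective {N = N} F refl {false ∷ []} {true ∷ []} eq =
  contradiction (trans (sym (IsFrame.q-frame F zero)) (trans (cong q (sym eq)) (q-0ᵥ {N}))) λ ()
combine-injective {w = w} F t {a ∷ b ∷ z} {a′ ∷ b′ ∷ z′} eq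
  with trans (sym (B₁-combine F a b z)) (trans (cong (B (w (suc zero))) eq) (B₁-combine F a′ b′ z′))
     | trans (sym (B₀-combine F a b z)) (trans (cong (B (w zero)) eq) (B₀-combine F a′ b′ z′))
... | refl | refl = cong (λ y → a ∷ b ∷ y)
  (combine-injective (reduce-isFrame F) t (+ᵥ-cancelˡ (a · w zero +ᵥ b · w (suc zero)) eq))

-- Counting

module _ {A : Set} where

  ∈-─ : ∀ {x y : A} {ys} (x∈ys : x ∈ ys) → y ∈ ys → y ≢ x → y ∈ ys ─ x∈ys
  ∈-─ (here refl) (here refl) y≢x = contradiction refl y≢x
  ∈-─ (here _) (there y∈ys) _ = y∈ys
  ∈-─ (there _) (here y≡z) _ = here y≡z
  ∈-─ (there x∈ys) (there y∈ys) y≢x = there (∈-─ x∈ys y∈ys y≢x)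

  Unique⇒length≤ : ∀ {xs ys : List A} → Unique xs → xs ⊆ ys → length xs ≤ length ys
  Unique⇒length≤ [] _ = z≤n
  Unique⇒length≤ {x ∷ xs} {ys} (x∉xs ∷ u) xs⊆ys = begin
    suc (length xs)           ≤⟨ s≤s (Unique⇒length≤ u xs⊆ys─x) ⟩
    suc (length (ys ─ x∈ys))  ≡⟨ length-removeAt′ ys (index x∈ys) ⟨
    length ys                 ∎
    where
    open ≤-Reasoning
    x∈ys = xs⊆ys (here refl)
    xs⊆ys─x : xs ⊆ ys ─ x∈ys
    xs⊆ys─x y∈xs = ∈-─ x∈ys (xs⊆ys (there y∈xs)) (λ y≡x → All.lookup x∉xs y∈xs (sym y≡x))

injection-length≤ : ∀ {A B : Set} {f : A → B} {xs ys} → (∀ {x y} → f x ≡ f y → x ≡ y) →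
                    Unique xs → (∀ {x} → x ∈ xs → f x ∈ ys) → length xs ≤ length ys
injection-length≤ {f = f} {xs} inj u f∈ys =
  subst (_≤ _) (length-map f xs) (Unique⇒length≤ (Unique.map⁺ inj u) λ y∈ → case ∈-map⁻ f y∈ of λ where
    (x , x∈xs , refl) → f∈ys x∈xs)

count : {A : Set} → (A → Bool) → List A → ℕ
count p xs = length (filterᵇ p xs)

count-map : ∀ {A B : Set} (p : B → Bool) (f : A → B) xs → count p (map f xs) ≡ count (p ∘ f) xs
count-map p f [] = refl
count-map p f (x ∷ xs) with p (f x)
... | true  = cong suc (count-map p f xs)
... | false = count-map p f xs

vectors : ∀ n → List (Vec Bool n)
vectors zero = [] ∷ []
vectors (suc n) = cartesianProductWith _∷_ (false ∷ true ∷ []) (vectors n)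

∈-vectors : ∀ (x : Vec Bool n) → x ∈ vectors n
∈-vectors [] = here refl
∈-vectors (a ∷ x) = ∈-cartesianProductWith⁺ _∷_ (∈-bools a) (∈-vectors x)
  where
  ∈-bools : ∀ a → a ∈ false ∷ true ∷ []
  ∈-bools false = here refl
  ∈-bools true  = there (here refl)

vectors-unique : ∀ n → Unique (vectors n)
vectors-unique zero = [] ∷ []
vectors-unique (suc n) =
  Unique.cartesianProductWith⁺ _∷_ ∷-injective (((λ ()) ∷ []) ∷ [] ∷ []) (vectors-unique n)

length-vectors : ∀ n → length (vectors n) ≡ 2 ^ n
length-vectors zero = refl
length-vectors (suc n) =
  trans (length-++ (map (false ∷_) (vectors n)))
        (cong₂ _+_ (trans (length-map (false ∷_) (vectors n)) (length-vectors n))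
                   (trans (length-++ (map (true ∷_) (vectors n)))
                          (cong (_+ 0) (trans (length-map (true ∷_) (vectors n)) (length-vectors n)))))

count-vectors : ∀ n (p : Vec Bool (suc n) → Bool) →
                count p (vectors (suc n)) ≡ count (p ∘ (false ∷_)) (vectors n) + count (p ∘ (true ∷_)) (vectors n)
count-vectors n p = begin
  count p (map (false ∷_) vs ++ (map (true ∷_) vs ++ []))
    ≡⟨ count-++ (map (false ∷_) vs) (map (true ∷_) vs ++ []) ⟩
  count p (map (false ∷_) vs) + count p (map (true ∷_) vs ++ [])
    ≡⟨ cong (λ k → count p (map (false ∷_) vs) + k) (cong (count p) (++-identityʳ (map (true ∷_) vs))) ⟩
  count p (map (false ∷_) vs) + count p (map (true ∷_) vs)
    ≡⟨ cong₂ _+_ (count-map p (false ∷_) vs) (count-map p (true ∷_) vs) ⟩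
  count (p ∘ (false ∷_)) vs + count (p ∘ (true ∷_)) vs
    ∎
  where
  open ≡-Reasoning
  vs = vectors n
  count-++ : ∀ xs ys → count p (xs ++ ys) ≡ count p xs + count p ys
  count-++ xs ys = trans (cong length (filter-++ (T? ∘ p) xs ys)) (length-++ (filterᵇ p xs))

module _ {c : Bool} {w : Fin n → Vec Bool N} (F : IsFrame c w) (t : TailNonzero c n) where

  frame-length≤ : n ≤ N
  frame-length≤ = ≮⇒≥ λ N<n → <⇒≱ (^-monoʳ-< 2 (s≤s (s≤s z≤n)) N<n) 2^n≤2^N
    where
    2^n≤2^N : 2 ^ n ≤ 2 ^ N
    2^n≤2^N = subst₂ _≤_ (length-vectors n) (length-vectors N)
                (injection-length≤ (combine-injective F t) (vectors-unique n) (λ _ → ∈-vectors _))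

  frame-count≤ : count (frameForm c) (vectors n) ≤ count q (vectors N)
  frame-count≤ =
    injection-length≤ (combine-injective F t) (Unique.filter⁺ (T? ∘ frameForm c) (vectors-unique n)) q-true
    where
    q-true : ∀ {z} → z ∈ filterᵇ (frameForm c) (vectors n) → combine w z ∈ filterᵇ q (vectors N)
    q-true {z} z∈ = ∈-filter⁺ (T? ∘ q) (∈-vectors _)
      (subst T (sym (q-combine F z)) (proj₂ (∈-filter⁻ (T? ∘ frameForm c) {xs = vectors n} z∈)))

-- Biases

sign : Bool → ℤ
sign false = 1ℤ
sign true  = -1ℤ

sign-xor : ∀ a b → sign (a xor b) ≡ sign a ℤ.* sign b
sign-xor false false = refl
sign-xor false true  = refl
sign-xor true  false = refl
sign-xor true  true  = refl

bias : ∀ n → (Vec Bool n → Bool) → ℤ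
bias zero f = sign (f [])
bias (suc n) f = bias n (f ∘ (false ∷_)) ℤ.+ bias n (f ∘ (true ∷_))

bias-cong : ∀ n {f g : Vec Bool n → Bool} → (∀ z → f z ≡ g z) → bias n f ≡ bias n g
bias-cong zero f≗g = cong sign (f≗g [])
bias-cong (suc n) f≗g = cong₂ ℤ._+_ (bias-cong n (f≗g ∘ (false ∷_))) (bias-cong n (f≗g ∘ (true ∷_)))

bias-xorˡ : ∀ n b (f : Vec Bool n → Bool) → bias n (λ z → b xor f z) ≡ sign b ℤ.* bias n f
bias-xorˡ zero b f = sign-xor b (f [])
bias-xorˡ (suc n) b f =
  trans (cong₂ ℤ._+_ (bias-xorˡ n b (f ∘ (false ∷_))) (bias-xorˡ n b (f ∘ (true ∷_))))
        (sym (ℤ.*-distribˡ-+ (sign b) (bias n (f ∘ (false ∷_))) (bias n (f ∘ (true ∷_)))))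

pairBias : (Bool → Bool → Bool) → ℤ
pairBias f = (sign (f false false) ℤ.+ sign (f false true)) ℤ.+ (sign (f true false) ℤ.+ sign (f true true))

bias-∷∷ : ∀ n (F : Vec Bool (suc (suc n)) → Bool) f (G : Vec Bool n → Bool) →
          (∀ a b z → F (a ∷ b ∷ z) ≡ f a b xor G z) → bias (suc (suc n)) F ≡ pairBias f ℤ.* bias n G
bias-∷∷ n F f G F≗ =
  trans (cong₂ ℤ._+_ (cong₂ ℤ._+_ (piece false false) (piece false true))
                     (cong₂ ℤ._+_ (piece true false) (piece true true)))
        (collect (sign (f false false)) (sign (f false true)) (sign (f true false)) (sign (f true true)) (bias n G))
  where
  piece : ∀ a b → bias n (λ z → F (a ∷ b ∷ z)) ≡ sign (f a b) ℤ.* bias n G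
  piece a b = trans (bias-cong n (F≗ a b)) (bias-xorˡ n (f a b) G)
  collect : ∀ s t u v β → (s ℤ.* β ℤ.+ t ℤ.* β) ℤ.+ (u ℤ.* β ℤ.+ v ℤ.* β) ≡ ((s ℤ.+ t) ℤ.+ (u ℤ.+ v)) ℤ.* β
  collect = ℤ-Solver.solve-∀

bias-count : ∀ n (f : Vec Bool n → Bool) → bias n f ≡ + 2 ^ n ℤ.- + (2 * count f (vectors n))
bias-count zero f with f []
... | true  = refl
... | false = refl
bias-count (suc n) f = begin
  bias n f₀ ℤ.+ bias n f₁
    ≡⟨ cong₂ ℤ._+_ (bias-count n f₀) (bias-count n f₁) ⟩
  (+ 2 ^ n ℤ.- + (2 * c₀)) ℤ.+ (+ 2 ^ n ℤ.- + (2 * c₁))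
    ≡⟨ regroup (+ 2 ^ n) (+ (2 * c₀)) (+ (2 * c₁)) ⟩
  (+ 2 ^ n ℤ.+ + 2 ^ n) ℤ.- (+ (2 * c₀) ℤ.+ + (2 * c₁))
    ≡⟨ cong₂ ℤ._-_ (ℤ.pos-+ (2 ^ n) (2 ^ n)) (ℤ.pos-+ (2 * c₀) (2 * c₁)) ⟨
  + (2 ^ n + 2 ^ n) ℤ.- + (2 * c₀ + 2 * c₁)
    ≡⟨ cong₂ (λ a b → + a ℤ.- + b) (cong (λ k → 2 ^ n + k) (sym (+-identityʳ (2 ^ n))))
                                     (trans (sym (*-distribˡ-+ 2 c₀ c₁)) (cong (2 *_) (sym (count-vectors n f)))) ⟩
  + 2 ^ suc n ℤ.- + (2 * count f (vectors (suc n)))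
    ∎
  where
  open ≡-Reasoning
  f₀ f₁ : Vec Bool n → Bool
  f₀ = f ∘ (false ∷_)
  f₁ = f ∘ (true ∷_)
  c₀ = count f₀ (vectors n)
  c₁ = count f₁ (vectors n)
  regroup : ∀ p x y → (p ℤ.- x) ℤ.+ (p ℤ.- y) ≡ (p ℤ.+ p) ℤ.- (x ℤ.+ y)
  regroup = ℤ-Solver.solve-∀

count≤⇒bias≥ : ∀ n {f g : Vec Bool n → Bool} → count f (vectors n) ≤ count g (vectors n) → bias n g ℤ.≤ bias n f
count≤⇒bias≥ n {f} {g} f≤g = subst₂ ℤ._≤_ (sym (bias-count n g)) (sym (bias-count n f))
  (ℤ.+-monoʳ-≤ (+ 2 ^ n) (ℤ.neg-mono-≤ (ℤ.+≤+ (*-monoʳ-≤ 2 f≤g))))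

bias-q-positive : ∀ N → 0ℤ ℤ.< bias N q
bias-q-positive zero = ℤ.+<+ (s≤s z≤n)
bias-q-positive (suc zero) = ℤ.+<+ (s≤s z≤n)
bias-q-positive (suc (suc N)) =
  subst (0ℤ ℤ.<_) (sym (bias-∷∷ N q (λ a b → a ∧ not b) q q-∷∷)) (ℤ.*-monoˡ-<-pos (+ 2) (bias-q-positive N))

bias-frameForm-4+ : ∀ n → bias (4 + n) (frameForm true) ≡ -[1+ 3 ] ℤ.* bias n (frameForm true)
bias-frameForm-4+ n =
  trans (pair true (2 + n))
        (trans (cong (pairBias (pairForm true) ℤ.*_) (pair false n))
               (sym (ℤ.*-assoc (pairBias (pairForm true)) (pairBias (pairForm false)) (bias n (frameForm true)))))
  where
  pair : ∀ c m → bias (2 + m) (frameForm c) ≡ pairBias (pairForm c) ℤ.* bias m (frameForm (not c))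
  pair c m = bias-∷∷ m (frameForm c) (pairForm c) (frameForm (not c)) λ _ _ _ → refl

bias-frameForm-negative : ∀ d {k} → bias k (frameForm true) ℤ.< 0ℤ → bias (d * 8 + k) (frameForm true) ℤ.< 0ℤ
bias-frameForm-negative zero neg = neg
bias-frameForm-negative (suc d) {k} neg =
  subst (ℤ._< 0ℤ) (sym 16*) (ℤ.*-monoˡ-<-pos (+ 16) (bias-frameForm-negative d neg))
  where
  β = bias (d * 8 + k) (frameForm true)
  16* : bias (8 + (d * 8 + k)) (frameForm true) ≡ + 16 ℤ.* β
  16* = trans (bias-frameForm-4+ (4 + (d * 8 + k)))
              (trans (cong (-[1+ 3 ] ℤ.*_) (bias-frameForm-4+ (d * 8 + k))) (sym (ℤ.*-assoc -[1+ 3 ] -[1+ 3 ] β)))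

bias-q≤bias-frameForm : ∀ {c} {w : Fin n → Vec Bool N} → n ≡ N → IsFrame c w → TailNonzero c n →
                        bias N q ℤ.≤ bias n (frameForm c)
bias-q≤bias-frameForm {n = n} refl F t = count≤⇒bias≥ n (frame-count≤ F t)

no-spanning-frame : ∀ d {k} → TailNonzero true k → bias k (frameForm true) ℤ.< 0ℤ → d * 8 + k ≡ N →
                    {w : Fin (d * 8 + k) → Vec Bool N} → ¬ IsFrame true w
no-spanning-frame {N = N} d {k} t neg eq F = ℤ.<-irrefl refl (begin-strict
  0ℤ                                 <⟨ bias-q-positive N ⟩
  bias N q                           ≤⟨ bias-q≤bias-frameForm eq F (tail-periodic d t) ⟩
  bias (d * 8 + k) (frameForm true)  <⟨ bias-frameForm-negative d neg ⟩
  0ℤ                                 ∎)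
  where open ℤ.≤-Reasoning

no-frame-of-size-ρ : ∀ r d → r < 4 → {w : Fin (d * 8 + 2 ^ r) → Vec Bool (2 * (r + d * 4))} → ¬ IsFrame true w
no-frame-of-size-ρ 0 d _ F = <⇒≱ (≤-reflexive (size d)) (frame-length≤ F (tail-periodic d refl))
  where
  size : ∀ d → suc (2 * (d * 4)) ≡ d * 8 + 1
  size = ℕ-Solver.solve-∀
no-frame-of-size-ρ 1 d _ F = no-spanning-frame d tt ℤ.-<+ (size d) F
  where
  size : ∀ d → d * 8 + 2 ≡ 2 * (1 + d * 4)
  size = ℕ-Solver.solve-∀
no-frame-of-size-ρ 2 d _ F = no-spanning-frame d tt ℤ.-<+ (size d) F
  where
  size : ∀ d → d * 8 + 4 ≡ 2 * (2 + d * 4)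
  size = ℕ-Solver.solve-∀
no-frame-of-size-ρ 3 d _ F =
  <⇒≱ (subst (2 * (3 + d * 4) <_) (size d) (m<n+m (2 * (3 + d * 4)) {2} (s≤s z≤n)))
      (frame-length≤ F (tail-periodic d tt))
  where
  size : ∀ d → 2 + 2 * (3 + d * 4) ≡ d * 8 + 8
  size = ℕ-Solver.solve-∀
no-frame-of-size-ρ (suc (suc (suc (suc r)))) d (s≤s (s≤s (s≤s (s≤s ()))))

frame-size<ρ : ∀ r d → r < 4 → {w : Fin n → Vec Bool (2 * (r + d * 4))} → IsFrame true w → n < 2 ^ r + 8 * d
frame-size<ρ {n = n} r d r<4 F =
  ≰⇒> λ ρ≤n → no-frame-of-size-ρ r d r<4 (IsFrame-restrict (subst (_≤ n) ρ-comm ρ≤n) F)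
  where
  ρ-comm : 2 ^ r + 8 * d ≡ d * 8 + 2 ^ r
  ρ-comm = trans (+-comm (2 ^ r) (8 * d)) (cong (λ k → k + 2 ^ r) (*-comm 8 d))

clique-size≤ρ : ∀ {m} r d → m ≡ r + d * 4 → r < 4 → ∀ k (v : Fin k → Vertex m) → IsClique m v → k ≤ 2 ^ r + 8 * d
clique-size≤ρ r d refl r<4 zero v cl = z≤n
clique-size≤ρ r d refl r<4 (suc k) v cl = frame-size<ρ r d r<4 (clique⇒frame {m = r + d * 4} cl)

-- The Hurwitz–Radon number is small

2+8d≤2^4d : ∀ e → 2 + 8 * suc e ≤ 2 ^ (suc e * 4)
2+8d≤2^4d zero = m≤m+n 10 6
2+8d≤2^4d (suc e) = begin
  2 + 8 * suc (suc e)      ≡⟨ shift e ⟩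
  8 + (2 + 8 * suc e)      ≤⟨ +-monoʳ-≤ 8 ih ⟩
  8 + X                    ≤⟨ +-monoˡ-≤ X 8≤X ⟩
  X + X                    ≤⟨ m≤m+n (X + X) (14 * X) ⟩
  X + X + 14 * X           ≡⟨ sixteen X ⟩
  2 * (2 * (2 * (2 * X)))  ∎
  where
  open ≤-Reasoning
  X = 2 ^ (suc e * 4)
  ih = 2+8d≤2^4d e
  8≤X : 8 ≤ X
  8≤X = ≤-trans (≤-trans (m≤m*n 8 (suc e)) (m≤n+m _ 2)) ih
  shift : ∀ e → 2 + 8 * suc (suc e) ≡ 8 + (2 + 8 * suc e)
  shift = ℕ-Solver.solve-∀
  sixteen : ∀ X → X + X + 14 * X ≡ 2 * (2 * (2 * (2 * X)))
  sixteen = ℕ-Solver.solve-∀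

ρ<2^m : ∀ {m} r d → m ≡ r + d * 4 → 0 < d → 2 ^ r + 8 * d < 2 ^ m
ρ<2^m r (suc e) refl _ = begin-strict
  2 ^ r + 8 * suc e            ≤⟨ +-monoʳ-≤ (2 ^ r) (m≤n*m (8 * suc e) (2 ^ r) {{m^n≢0 2 r}}) ⟩
  2 ^ r + 2 ^ r * (8 * suc e)  ≡⟨ *-suc (2 ^ r) (8 * suc e) ⟨
  2 ^ r * suc (8 * suc e)      <⟨ *-monoʳ-< (2 ^ r) {{m^n≢0 2 r}} (2+8d≤2^4d e) ⟩
  2 ^ r * 2 ^ (suc e * 4)      ≡⟨ ^-distribˡ-+-* 2 r (suc e * 4) ⟨
  2 ^ (r + suc e * 4)          ∎
  where open ≤-Reasoning

lemma3 : (∀ (m : ℕ) → 1 ≤ m → ∀ (k : ℕ) (v : Fin k → Vertex m) → IsClique m v → k ≤ ρHR m)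
       × (∀ (m : ℕ) → 4 ≤ m → ρHR m < 2 ^ m)
lemma3 = (λ m _ → clique-size≤ρ (m % 4) (m / 4) (m≡m%n+[m/n]*n m 4) (m%n<n m 4))
       , (λ m 4≤m → ρ<2^m (m % 4) (m / 4) (m≡m%n+[m/n]*n m 4) (m≥n⇒m/n>0 4≤m))
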